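{- Let $E$ be a ground set with $|E|=n$, let $f_1,\dots,f_N:2^E\to\mathbb{R}_{\ge0}$ be monotone submodular with $f_i(\emptyset)=0$, let $p_i\ge0$ with $\sum_ip_i=1$, and $F=\sum_ip_if_i$. For any polytope $\mathcal{P}\subseteq[0,1]^n$ with $\texttt{OPT}=\max_{\mathbf{x}\in\mathcal{P}}\widehat{F}(\mathbf{x})$, any $\mathbf{x}^{(t)}\in[0,1]^n$, and any $\mathbf{v}_i^{(t)}\in\arg\max_{\mathbf{y}\in\mathcal{P}}\langle\mathbf{y},\nabla\widehat{f}_i(\mathbf{x}^{(t)})\rangle$, $$\texttt{OPT}-\widehat{F}(\mathbf{x}^{(t)})\le\sum_{i=1}^Np_i\langle\mathbf{v}_i^{(t)},\nabla\widehat{f}_i(\mathbf{x}^{(t)})\rangle.$$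
   Context: The multilinear extension of $f:2^E\to\mathbb{R}$ is $\widehat{f}(\mathbf{x})=\sum_{S\subseteq E}f(S)\prod_{e\in S}\mathbf{x}(e)\prod_{e\notin S}(1-\mathbf{x}(e))$. -}

module Defs where

open import Level using (Level; _⊔_) renaming (suc to lsuc)
open import Data.Nat using (ℕ; zero; suc)
open import Data.Fin using (Fin; zero; suc; _≟_)
open import Data.Bool using (Bool; true; false; if_then_else_)
open import Data.Vec using (Vec; []; _∷_; lookup)
open import Data.List using (List; []; _∷_; map; _++_)
open import Data.Product using (Σ; _×_; _,_)
open import Function using (_∘_)
open import Relation.Nullary using (¬_; yes; no)
open import Relation.Binary.Core using (Rel)
open import Relation.Binary.Structures using (IsTotalOrder)
open import Algebra.Bundles using (CommutativeRing)
open import Data.Fin.Subset using (Subset; _⊆_; _∪_; _∩_) renaming (⊥ to ∅)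

-- An ordered field (the real numbers ℝ are an instance).
record OrderedField (c ℓ₁ ℓ₂ : Level) : Set (lsuc (c ⊔ ℓ₁ ⊔ ℓ₂)) where
  field
    commutativeRing : CommutativeRing c ℓ₁
  open CommutativeRing commutativeRing public
  infix 4 _≤_
  field
    _≤_         : Rel Carrier ℓ₂
    isTotalOrder : IsTotalOrder _≈_ _≤_
    +-monoˡ-≤   : ∀ {x y} z → x ≤ y → x + z ≤ y + z
    *-nonneg    : ∀ {x y} → 0# ≤ x → 0# ≤ y → 0# ≤ x * y
    0≉1         : ¬ (0# ≈ 1#)
    inverse     : ∀ x → ¬ (x ≈ 0#) → Σ Carrier (λ y → x * y ≈ 1#)

allSubsets : ∀ n → List (Subset n)
allSubsets zero    = [] ∷ []
allSubsets (suc n) = map (true ∷_) (allSubsets n) ++ map (false ∷_) (allSubsets n)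

module _ {c ℓ₁ ℓ₂} (K : OrderedField c ℓ₁ ℓ₂) where
  open OrderedField K using (Carrier; _≈_; _≤_; _+_; _*_; -_; _-_; 0#; 1#)

  sumFin : ∀ n → (Fin n → Carrier) → Carrier
  sumFin zero    g = 0#
  sumFin (suc n) g = g zero + sumFin n (g ∘ suc)

  prodFin : ∀ n → (Fin n → Carrier) → Carrier
  prodFin zero    g = 1#
  prodFin (suc n) g = g zero * prodFin n (g ∘ suc)

  sumList : ∀ {a} {A : Set a} → List A → (A → Carrier) → Carrier
  sumList []       g = 0#
  sumList (a ∷ as) g = g a + sumList as g

  inner : ∀ n → (Fin n → Carrier) → (Fin n → Carrier) → Carrier
  inner n x y = sumFin n (λ e → x e * y e)

  factor : ∀ {n} → Subset n → (Fin n → Carrier) → Fin n → Carrier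
  factor S x e = if lookup S e then x e else (1# - x e)

  multilinearExt : ∀ n → (Subset n → Carrier) → (Fin n → Carrier) → Carrier
  multilinearExt n f x = sumList (allSubsets n) (λ S → f S * prodFin n (factor S x))

  -- factor of e′ with the e-th factor differentiated away (d/dx(e) of the e-th factor
  -- is ±1, accounted for separately)
  factorExcept : ∀ {n} → Subset n → (Fin n → Carrier) → Fin n → Fin n → Carrier
  factorExcept S x e e′ with e′ ≟ e
  ... | yes _ = 1#
  ... | no  _ = factor S x e′

  -- ∂ f̂ / ∂ x(e): the partial derivative of the polynomial above, taken termwise
  gradMultilinearExt : ∀ n → (Subset n → Carrier) → (Fin n → Carrier) → Fin n → Carrier
  gradMultilinearExt n f x e =
    sumList (allSubsets n) (λ S →
      f S * ((if lookup S e then 1# else - 1#) * prodFin n (factorExcept S x e)))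

  Monotone : ∀ {n} → (Subset n → Carrier) → Set _
  Monotone f = ∀ S T → S ⊆ T → f S ≤ f T

  Submodular : ∀ {n} → (Subset n → Carrier) → Set _
  Submodular f = ∀ S T → f (S ∪ T) + f (S ∩ T) ≤ f S + f T

  NonNegative : ∀ {n} → (Subset n → Carrier) → Set _
  NonNegative f = ∀ S → 0# ≤ f S

  Normalized : ∀ {n} → (Subset n → Carrier) → Set _
  Normalized f = f ∅ ≈ 0#

  InUnitCube : ∀ n → (Fin n → Carrier) → Set _
  InUnitCube n x = ∀ e → (0# ≤ x e) × (x e ≤ 1#)

  InPolytope : ∀ {m} n → (Fin m → Fin n → Carrier) → (Fin m → Carrier) → (Fin n → Carrier) → Set _
  InPolytope {m} n A b x = ∀ j → inner n (A j) x ≤ b j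

  mixture : ∀ {n} N → (Fin N → Carrier) → (Fin N → Subset n → Carrier) → Subset n → Carrier
  mixture N p f S = sumFin N (λ i → p i * f i S)

{-# OPTIONS --safe #-}
-- For monotone submodular f and x, y in the unit cube put z = 1 - (1 - x)(1 - y) coordinatewise. Then
--   f̂(y) ≤ f̂(z) ≤ f̂(x) + ⟨z - x, ∇f̂(x)⟩ ≤ f̂(x) + ⟨y, ∇f̂(x)⟩:
-- f̂ is monotone on the cube; f̂ is concave along nonnegative directions, because ∂ₑf̂ is the
-- extension of the marginal gain of e, which submodularity makes antitone; and ∇f̂ ≥ 0 with
-- 0 ≤ z - x ≤ y. Take y to be a maximiser of F̂ = Σ pᵢ f̂ᵢ, bound ⟨y, ∇f̂ᵢ(x)⟩ by ⟨vᵢ, ∇f̂ᵢ(x)⟩ and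
-- average with the weights pᵢ. Every property of f̂ is proved by induction on n from
--   f̂(x) = x₀ f̂₁(x′) + (1 - x₀) f̂₀(x′),   where f_b(S) = f(S with membership of 0 set to b).
module Submission where

open import Defs
open import Data.Nat using (ℕ)
open import Data.Fin using (Fin)
open import Data.Product using (Σ; _×_)
open import Data.Fin.Subset using (Subset)

open import Algebra.Bundles using (CommutativeRing)
open import Algebra.Core using (Op₂)
import Algebra.Solver.Ring.AlmostCommutativeRing as AlmostCommutativeRing
open import Data.Bool using (Bool; true; false; if_then_else_)
open import Data.Bool.Properties using (∨-idem; ∧-idem)
open import Data.Fin using (zero; suc; _≟_)
open import Data.Fin.Subset using (_⊆_; _∪_; _∩_)
open import Data.Fin.Subset.Properties using (⊆-refl; s⊆s; out⊆; ∪-idem; ∩-idem)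
open import Data.Integer as ℤ using (ℤ; +_; -[1+_]; _◃_; _⊖_)
import Data.Integer.Properties as ℤₚ
open import Data.List using (List; []; _∷_; _++_; map)
open import Data.Maybe using (Maybe; just; nothing)
open import Data.Nat as ℕ using (zero; suc)
import Data.Nat.Properties as ℕₚ
open import Data.Product using (_,_; proj₁; proj₂)
open import Data.Sign as Sign using (Sign)
open import Data.Sum using (inj₁; inj₂)
open import Data.Vec using ([]; _∷_; _[_]≔_; lookup)
open import Data.Vec.Functional using (head; tail)
open import Function using (_∘_)
open import Relation.Binary.Bundles using (Poset)
open import Relation.Binary.PropositionalEquality as ≡ using (_≡_)
open import Relation.Binary.Structures using (IsTotalOrder)
open import Relation.Nullary using (yes; no)

-- Algebra.Solver.Ring with ℤ as coefficient ring: with the ring's own elements as coefficients,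
-- constants such as 1 - 1 would not normalise in an abstract commutative ring.
module IntegerCoefficientSolver {c ℓ} (R : CommutativeRing c ℓ) where
  open CommutativeRing R
  open import Algebra.Properties.Ring ring using (-‿involutive; -0#≈0#; -1*x≈-x)
  open import Algebra.Properties.AbelianGroup +-abelianGroup
    using (⁻¹-∙-comm; ⁻¹-anti-homo‿-; //-rightDividesʳ)
  open import Algebra.Properties.CommutativeSemigroup *-commutativeSemigroup using (interchange)
  open import Algebra.Properties.Semiring.Mult.TCOptimised semiring
    using (×-homo-+; ×1-homo-*) renaming (_×_ to _×ₙ_)
  open import Relation.Binary.Reasoning.Setoid setoid

  fromℕ : ℕ → Carrier
  fromℕ n = n ×ₙ 1#

  fromℤ : ℤ → Carrier
  fromℤ (+ n)    = fromℕ n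
  fromℤ -[1+ n ] = - fromℕ (ℕ.suc n)

  fromℤ-neg : ∀ i → fromℤ (ℤ.- i) ≈ - fromℤ i
  fromℤ-neg -[1+ n ]      = sym (-‿involutive _)
  fromℤ-neg (+ ℕ.zero)    = sym -0#≈0#
  fromℤ-neg (+ ℕ.suc n)   = refl

  fromℤ-⊖ : ∀ m n → fromℤ (m ⊖ n) ≈ fromℕ m - fromℕ n
  fromℤ-⊖ m n with ℕₚ.≤-total n m
  ... | inj₁ n≤m = begin
    fromℤ (m ⊖ n)                         ≡⟨ ≡.cong fromℤ (ℤₚ.⊖-≥ n≤m) ⟩
    fromℕ (m ℕ.∸ n)                       ≈⟨ //-rightDividesʳ (fromℕ n) _ ⟨
    fromℕ (m ℕ.∸ n) + fromℕ n - fromℕ n   ≈⟨ +-congʳ (×-homo-+ 1# (m ℕ.∸ n) n) ⟨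
    fromℕ (m ℕ.∸ n ℕ.+ n) - fromℕ n       ≡⟨ ≡.cong (λ k → fromℕ k - fromℕ n) (ℕₚ.m∸n+n≡m n≤m) ⟩
    fromℕ m - fromℕ n                     ∎
  ... | inj₂ m≤n = begin
    fromℤ (m ⊖ n)                           ≡⟨ ≡.cong fromℤ (ℤₚ.⊖-≤ m≤n) ⟩
    fromℤ (ℤ.- + (n ℕ.∸ m))                 ≈⟨ fromℤ-neg (+ (n ℕ.∸ m)) ⟩
    - fromℕ (n ℕ.∸ m)                       ≈⟨ -‿cong (//-rightDividesʳ (fromℕ m) _) ⟨
    - (fromℕ (n ℕ.∸ m) + fromℕ m - fromℕ m) ≈⟨ ⁻¹-anti-homo‿- _ _ ⟩
    fromℕ m - (fromℕ (n ℕ.∸ m) + fromℕ m)   ≈⟨ +-congˡ (-‿cong (×-homo-+ 1# (n ℕ.∸ m) m)) ⟨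
    fromℕ m - fromℕ (n ℕ.∸ m ℕ.+ m)         ≡⟨ ≡.cong (λ k → fromℕ m - fromℕ k) (ℕₚ.m∸n+n≡m m≤n) ⟩
    fromℕ m - fromℕ n                       ∎

  fromℤ-+ : ∀ i j → fromℤ (i ℤ.+ j) ≈ fromℤ i + fromℤ j
  fromℤ-+ -[1+ m ] -[1+ n ] = begin
    - fromℕ (ℕ.suc (ℕ.suc (m ℕ.+ n)))        ≡⟨ ≡.cong (λ k → - fromℕ (ℕ.suc k)) (ℕₚ.+-suc m n) ⟨
    - fromℕ (ℕ.suc m ℕ.+ ℕ.suc n)            ≈⟨ -‿cong (×-homo-+ 1# (ℕ.suc m) (ℕ.suc n)) ⟩
    - (fromℕ (ℕ.suc m) + fromℕ (ℕ.suc n))    ≈⟨ ⁻¹-∙-comm _ _ ⟨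
    - fromℕ (ℕ.suc m) + - fromℕ (ℕ.suc n)    ∎
  fromℤ-+ -[1+ m ] (+ n)    = trans (fromℤ-⊖ n (ℕ.suc m)) (+-comm _ _)
  fromℤ-+ (+ m)    -[1+ n ] = fromℤ-⊖ m (ℕ.suc n)
  fromℤ-+ (+ m)    (+ n)    = ×-homo-+ 1# m n

  fromSign : Sign → Carrier
  fromSign Sign.+ = 1#
  fromSign Sign.- = - 1#

  fromSign-* : ∀ s t → fromSign (s Sign.* t) ≈ fromSign s * fromSign t
  fromSign-* Sign.- Sign.- = sym (trans (-1*x≈-x (- 1#)) (-‿involutive 1#))
  fromSign-* Sign.- Sign.+ = sym (*-identityʳ _)
  fromSign-* Sign.+ t      = sym (*-identityˡ _)

  fromℤ-◃ : ∀ s k → fromℤ (s ◃ k) ≈ fromSign s * fromℕ k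
  fromℤ-◃ s       ℕ.zero    = sym (zeroʳ (fromSign s))
  fromℤ-◃ Sign.+ (ℕ.suc k) = sym (*-identityˡ _)
  fromℤ-◃ Sign.- (ℕ.suc k) = sym (-1*x≈-x _)

  fromℤ-sign-abs : ∀ i → fromℤ i ≈ fromSign (ℤ.sign i) * fromℕ ℤ.∣ i ∣
  fromℤ-sign-abs i =
    trans (reflexive (≡.cong fromℤ (≡.sym (ℤₚ.◃-inverse i)))) (fromℤ-◃ (ℤ.sign i) ℤ.∣ i ∣)

  fromℤ-* : ∀ i j → fromℤ (i ℤ.* j) ≈ fromℤ i * fromℤ j
  fromℤ-* i j = begin
    fromℤ (i ℤ.* j)
      ≈⟨ fromℤ-◃ (ℤ.sign i Sign.* ℤ.sign j) (ℤ.∣ i ∣ ℕ.* ℤ.∣ j ∣) ⟩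
    fromSign (ℤ.sign i Sign.* ℤ.sign j) * fromℕ (ℤ.∣ i ∣ ℕ.* ℤ.∣ j ∣)
      ≈⟨ *-cong (fromSign-* (ℤ.sign i) (ℤ.sign j)) (×1-homo-* ℤ.∣ i ∣ ℤ.∣ j ∣) ⟩
    (fromSign (ℤ.sign i) * fromSign (ℤ.sign j)) * (fromℕ ℤ.∣ i ∣ * fromℕ ℤ.∣ j ∣)
      ≈⟨ interchange _ _ _ _ ⟩
    (fromSign (ℤ.sign i) * fromℕ ℤ.∣ i ∣) * (fromSign (ℤ.sign j) * fromℕ ℤ.∣ j ∣)
      ≈⟨ *-cong (fromℤ-sign-abs i) (fromℤ-sign-abs j) ⟨
    fromℤ i * fromℤ j ∎

  open AlmostCommutativeRing using (_-Raw-AlmostCommutative⟶_; fromCommutativeRing)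

  fromℤ-morphism : ℤ.+-*-rawRing -Raw-AlmostCommutative⟶ fromCommutativeRing R
  fromℤ-morphism = record
    { ⟦_⟧ = fromℤ ; +-homo = fromℤ-+ ; *-homo = fromℤ-* ; -‿homo = fromℤ-neg
    ; 0-homo = refl ; 1-homo = refl }

  fromℤ-≟ : ∀ i j → Maybe (fromℤ i ≈ fromℤ j)
  fromℤ-≟ i j with i ℤ.≟ j
  ... | yes i≡j = just (reflexive (≡.cong fromℤ i≡j))
  ... | no _    = nothing

  open import Algebra.Solver.Ring ℤ.+-*-rawRing (fromCommutativeRing R) fromℤ-morphism fromℤ-≟ public
    using (Polynomial; solve; _:=_; _:+_; _:*_; :-_; _:-_; con)

  1ₚ : ∀ {m} → Polynomial m
  1ₚ = con (+ 1)

module OrderedFieldProperties {c ℓ₁ ℓ₂} (K : OrderedField c ℓ₁ ℓ₂) where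
  open OrderedField K hiding (zero)
  open IntegerCoefficientSolver commutativeRing using (solve; _:=_; _:+_; _:*_; _:-_)

  poset : Poset c ℓ₁ ℓ₂
  poset = record { isPartialOrder = IsTotalOrder.isPartialOrder isTotalOrder }

  open Poset poset public
    using (≤-respˡ-≈; ≤-respʳ-≈)
    renaming (refl to ≤-refl; reflexive to ≤-reflexive; trans to ≤-trans)

  x≤y⇒0≤y-x : ∀ {x y} → x ≤ y → 0# ≤ y - x
  x≤y⇒0≤y-x {x} h = ≤-respˡ-≈ (-‿inverseʳ x) (+-monoˡ-≤ (- x) h)

  ≤-by-difference : ∀ {x y} d → y - x ≈ d → 0# ≤ d → x ≤ y
  ≤-by-difference {x} {y} d y-x≈d 0≤d =
    ≤-respʳ-≈ (solve 2 (λ x y → (y :- x) :+ x := y) refl x y)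
      (≤-respˡ-≈ (+-identityˡ x) (+-monoˡ-≤ x (≤-respʳ-≈ (sym y-x≈d) 0≤d)))

  +-mono-≤ : ∀ {x x′ y y′} → x ≤ x′ → y ≤ y′ → x + y ≤ x′ + y′
  +-mono-≤ {x} {x′} {y} {y′} x≤x′ y≤y′ =
    ≤-trans (+-monoˡ-≤ y x≤x′)
            (≤-respˡ-≈ (+-comm y x′) (≤-respʳ-≈ (+-comm y′ x′) (+-monoˡ-≤ x′ y≤y′)))

  +-monoʳ-≤ : ∀ x {y y′} → y ≤ y′ → x + y ≤ x + y′
  +-monoʳ-≤ x = +-mono-≤ ≤-refl

  +-nonneg : ∀ {x y} → 0# ≤ x → 0# ≤ y → 0# ≤ x + y
  +-nonneg 0≤x 0≤y = ≤-respˡ-≈ (+-identityʳ 0#) (+-mono-≤ 0≤x 0≤y)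

  *-monoʳ-≤-nonneg : ∀ {k x y} → 0# ≤ k → x ≤ y → k * x ≤ k * y
  *-monoʳ-≤-nonneg {k} {x} {y} 0≤k x≤y = ≤-by-difference (k * (y - x))
    (solve 3 (λ k x y → k :* y :- k :* x := k :* (y :- x)) refl k x y)
    (*-nonneg 0≤k (x≤y⇒0≤y-x x≤y))

  x≤x+y : ∀ {x y} → 0# ≤ y → x ≤ x + y
  x≤x+y {x} {y} 0≤y = ≤-by-difference y (solve 2 (λ x y → (x :+ y) :- x := y) refl x y) 0≤y

  *-monoˡ-≤-nonneg : ∀ {k x y} → 0# ≤ k → x ≤ y → x * k ≤ y * k
  *-monoˡ-≤-nonneg {k} {x} {y} 0≤k x≤y =
    ≤-respˡ-≈ (*-comm k x) (≤-respʳ-≈ (*-comm k y) (*-monoʳ-≤-nonneg 0≤k x≤y))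

  x≤y+z⇒x-y≤z : ∀ {x y z} → x ≤ y + z → x - y ≤ z
  x≤y+z⇒x-y≤z {x} {y} {z} x≤y+z = ≤-by-difference ((y + z) - x)
    (solve 3 (λ x y z → z :- (x :- y) := (y :+ z) :- x) refl x y z)
    (x≤y⇒0≤y-x x≤y+z)

  x+y≤z+w⇒x-z≤w-y : ∀ {x y z w} → x + y ≤ z + w → x - z ≤ w - y
  x+y≤z+w⇒x-z≤w-y {x} {y} {z} {w} x+y≤z+w = ≤-by-difference ((z + w) - (x + y))
    (solve 4 (λ x y z w → (w :- y) :- (x :- z) := (z :+ w) :- (x :+ y)) refl x y z w)
    (x≤y⇒0≤y-x x+y≤z+w)

module Interpolation {c ℓ₁ ℓ₂} (K : OrderedField c ℓ₁ ℓ₂) where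
  open OrderedField K hiding (zero)
  open OrderedFieldProperties K
  open IntegerCoefficientSolver commutativeRing
    using (Polynomial; solve; _:=_; _:+_; _:*_; _:-_; 1ₚ)

  interpolate : Carrier → Carrier → Carrier → Carrier
  interpolate t a b = t * a + (1# - t) * b

  InUnitInterval : Carrier → Set ℓ₂
  InUnitInterval t = 0# ≤ t × t ≤ 1#

  private
    interpolateₚ : ∀ {m} → Polynomial m → Polynomial m → Polynomial m → Polynomial m
    interpolateₚ t a b = t :* a :+ (1ₚ :- t) :* b

  interpolate-cong : ∀ t {a a′ b b′} → a ≈ a′ → b ≈ b′ → interpolate t a b ≈ interpolate t a′ b′
  interpolate-cong t a≈a′ b≈b′ = +-cong (*-congˡ a≈a′) (*-congˡ b≈b′)

  interpolate-const : ∀ t a → interpolate t a a ≈ a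
  interpolate-const = solve 2 (λ t a → interpolateₚ t a a := a) refl

  interpolate-+ : ∀ t a b a′ b′ →
    interpolate t (a + a′) (b + b′) ≈ interpolate t a b + interpolate t a′ b′
  interpolate-+ = solve 5 (λ t a b a′ b′ →
    interpolateₚ t (a :+ a′) (b :+ b′) := interpolateₚ t a b :+ interpolateₚ t a′ b′) refl

  interpolate-difference : ∀ t a b a′ b′ →
    interpolate t (a - a′) (b - b′) ≈ interpolate t a b - interpolate t a′ b′
  interpolate-difference = solve 5 (λ t a b a′ b′ →
    interpolateₚ t (a :- a′) (b :- b′) := interpolateₚ t a b :- interpolateₚ t a′ b′) refl

  interpolate-*ˡ : ∀ t k a b → interpolate t (k * a) (k * b) ≈ k * interpolate t a b
  interpolate-*ˡ =
    solve 4 (λ t k a b → interpolateₚ t (k :* a) (k :* b) := k :* interpolateₚ t a b) refl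

  interpolate-+-weight : ∀ t d a b → interpolate (t + d) a b ≈ interpolate t a b + d * (a - b)
  interpolate-+-weight = solve 4 (λ t d a b →
    interpolateₚ (t :+ d) a b := interpolateₚ t a b :+ d :* (a :- b)) refl

  interpolate-mono-endpoints : ∀ {t a a′ b b′} → InUnitInterval t → a ≤ a′ → b ≤ b′ →
                               interpolate t a b ≤ interpolate t a′ b′
  interpolate-mono-endpoints {t} {a} {a′} {b} {b′} (0≤t , t≤1) a≤a′ b≤b′ =
    ≤-by-difference (t * (a′ - a) + (1# - t) * (b′ - b))
      (solve 5 (λ t a a′ b b′ → interpolateₚ t a′ b′ :- interpolateₚ t a b
                              := t :* (a′ :- a) :+ (1ₚ :- t) :* (b′ :- b)) refl t a a′ b b′)
      (+-nonneg (*-nonneg 0≤t (x≤y⇒0≤y-x a≤a′))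
                (*-nonneg (x≤y⇒0≤y-x t≤1) (x≤y⇒0≤y-x b≤b′)))

  interpolate-mono-weight : ∀ {s t a b} → s ≤ t → b ≤ a → interpolate s a b ≤ interpolate t a b
  interpolate-mono-weight {s} {t} {a} {b} s≤t b≤a = ≤-by-difference ((t - s) * (a - b))
    (solve 4 (λ s t a b → interpolateₚ t a b :- interpolateₚ s a b := (t :- s) :* (a :- b)) refl s t a b)
    (*-nonneg (x≤y⇒0≤y-x s≤t) (x≤y⇒0≤y-x b≤a))

  interpolate-anti-weight : ∀ {s t a b} → s ≤ t → a ≤ b → interpolate t a b ≤ interpolate s a b
  interpolate-anti-weight {s} {t} {a} {b} s≤t a≤b = ≤-by-difference ((t - s) * (b - a))
    (solve 4 (λ s t a b → interpolateₚ s a b :- interpolateₚ t a b := (t :- s) :* (b :- a)) refl s t a b)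
    (*-nonneg (x≤y⇒0≤y-x s≤t) (x≤y⇒0≤y-x a≤b))

module FiniteSums {c ℓ₁ ℓ₂} (K : OrderedField c ℓ₁ ℓ₂) where
  open OrderedField K hiding (zero)
  open OrderedFieldProperties K
  open Interpolation K
  open import Algebra.Properties.CommutativeSemigroup +-commutativeSemigroup using (interchange)

  sumFin-cong : ∀ n {g h} → (∀ i → g i ≈ h i) → sumFin K n g ≈ sumFin K n h
  sumFin-cong zero    g≈h = refl
  sumFin-cong (suc n) g≈h = +-cong (g≈h zero) (sumFin-cong n (g≈h ∘ suc))

  sumFin-+ : ∀ n g h → sumFin K n (λ i → g i + h i) ≈ sumFin K n g + sumFin K n h
  sumFin-+ zero    g h = sym (+-identityʳ 0#)
  sumFin-+ (suc n) g h = trans (+-congˡ (sumFin-+ n (g ∘ suc) (h ∘ suc))) (interchange _ _ _ _)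

  sumFin-mono-≤ : ∀ n {g h} → (∀ i → g i ≤ h i) → sumFin K n g ≤ sumFin K n h
  sumFin-mono-≤ zero    g≤h = ≤-refl
  sumFin-mono-≤ (suc n) g≤h = +-mono-≤ (g≤h zero) (sumFin-mono-≤ n (g≤h ∘ suc))

  sumFin-interpolate : ∀ n t g h →
    sumFin K n (λ i → interpolate t (g i) (h i)) ≈ interpolate t (sumFin K n g) (sumFin K n h)
  sumFin-interpolate zero    t g h = sym (interpolate-const t 0#)
  sumFin-interpolate (suc n) t g h =
    trans (+-congˡ (sumFin-interpolate n t (g ∘ suc) (h ∘ suc))) (sym (interpolate-+ t _ _ _ _))

  module _ {a} {A : Set a} where

    sumList-cong : ∀ (xs : List A) {g h} → (∀ s → g s ≈ h s) → sumList K xs g ≈ sumList K xs h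
    sumList-cong []       g≈h = refl
    sumList-cong (s ∷ xs) g≈h = +-cong (g≈h s) (sumList-cong xs g≈h)

    sumList-++ : ∀ (xs ys : List A) g → sumList K (xs ++ ys) g ≈ sumList K xs g + sumList K ys g
    sumList-++ []       ys g = sym (+-identityˡ _)
    sumList-++ (s ∷ xs) ys g = trans (+-congˡ (sumList-++ xs ys g)) (sym (+-assoc _ _ _))

    *-distribˡ-sumList : ∀ k (xs : List A) g → k * sumList K xs g ≈ sumList K xs (λ s → k * g s)
    *-distribˡ-sumList k []       g = zeroʳ k
    *-distribˡ-sumList k (s ∷ xs) g = trans (distribˡ k _ _) (+-congˡ (*-distribˡ-sumList k xs g))

    sumList-map : ∀ {b} {B : Set b} (h : A → B) (xs : List A) g →
                  sumList K (map h xs) g ≡ sumList K xs (g ∘ h)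
    sumList-map h []       g = ≡.refl
    sumList-map h (s ∷ xs) g = ≡.cong (λ t → g (h s) + t) (sumList-map h xs g)

  prodFin-cong : ∀ n {g h} → (∀ i → g i ≡ h i) → prodFin K n g ≡ prodFin K n h
  prodFin-cong zero    g≡h = ≡.refl
  prodFin-cong (suc n) g≡h = ≡.cong₂ _*_ (g≡h zero) (prodFin-cong n (g≡h ∘ suc))

  sumList-allSubsets-suc : ∀ n {g : Subset (suc n) → Carrier} {g₁ g₀ : Subset n → Carrier} a b →
    (∀ S → g (true ∷ S) ≈ a * g₁ S) → (∀ S → g (false ∷ S) ≈ b * g₀ S) →
    sumList K (allSubsets (suc n)) g ≈ a * sumList K (allSubsets n) g₁ + b * sumList K (allSubsets n) g₀
  sumList-allSubsets-suc n {g} a b g₁-part g₀-part = begin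
    sumList K (allSubsets (suc n)) g
      ≈⟨ sumList-++ (map (true ∷_) (allSubsets n)) (map (false ∷_) (allSubsets n)) g ⟩
    sumList K (map (true ∷_) (allSubsets n)) g + sumList K (map (false ∷_) (allSubsets n)) g
      ≡⟨ ≡.cong₂ _+_ (sumList-map (true ∷_) (allSubsets n) g)
                     (sumList-map (false ∷_) (allSubsets n) g) ⟩
    sumList K (allSubsets n) (g ∘ (true ∷_)) + sumList K (allSubsets n) (g ∘ (false ∷_))
      ≈⟨ +-cong (trans (sumList-cong (allSubsets n) g₁-part)
                       (sym (*-distribˡ-sumList a (allSubsets n) _)))
                (trans (sumList-cong (allSubsets n) g₀-part)
                       (sym (*-distribˡ-sumList b (allSubsets n) _))) ⟩
    a * sumList K (allSubsets n) _ + b * sumList K (allSubsets n) _ ∎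
    where open import Relation.Binary.Reasoning.Setoid setoid

p[e]≔false⊆p[e]≔true : ∀ {n} (p : Subset n) e → p [ e ]≔ false ⊆ p [ e ]≔ true
p[e]≔false⊆p[e]≔true (b ∷ p) zero    = out⊆ ⊆-refl
p[e]≔false⊆p[e]≔true (b ∷ p) (suc e) = s⊆s (p[e]≔false⊆p[e]≔true p e)

p[e]≔false∪p[e]≔true : ∀ {n} (p : Subset n) e →
                       (p [ e ]≔ false) ∪ (p [ e ]≔ true) ≡ p [ e ]≔ true
p[e]≔false∪p[e]≔true (b ∷ p) zero    = ≡.cong (true ∷_) (∪-idem p)
p[e]≔false∪p[e]≔true (b ∷ p) (suc e) = ≡.cong₂ _∷_ (∨-idem b) (p[e]≔false∪p[e]≔true p e)

p[e]≔false∩p[e]≔true : ∀ {n} (p : Subset n) e →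
                       (p [ e ]≔ false) ∩ (p [ e ]≔ true) ≡ p [ e ]≔ false
p[e]≔false∩p[e]≔true (b ∷ p) zero    = ≡.cong (false ∷_) (∩-idem p)
p[e]≔false∩p[e]≔true (b ∷ p) (suc e) = ≡.cong₂ _∷_ (∧-idem b) (p[e]≔false∩p[e]≔true p e)

module MultilinearExtensionProperties {c ℓ₁ ℓ₂} (K : OrderedField c ℓ₁ ℓ₂) where
  open OrderedField K hiding (zero)
  open OrderedFieldProperties K
  open Interpolation K
  open FiniteSums K
  open IntegerCoefficientSolver commutativeRing using (solve; _:=_; _:+_; _:*_; :-_; _:-_; 1ₚ)
  open import Algebra.Properties.CommutativeSemigroup *-commutativeSemigroup using (x∙yz≈y∙xz)
  open import Algebra.Definitions _≈_ using (Congruent₂)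
  open import Relation.Binary.Reasoning.PartialOrder poset

  private
    ext : ∀ n → (Subset n → Carrier) → (Fin n → Carrier) → Carrier
    ext = multilinearExt K

    ∇ : ∀ n → (Subset n → Carrier) → (Fin n → Carrier) → Fin n → Carrier
    ∇ = gradMultilinearExt K

  multilinearExt-zero : ∀ f x → ext 0 f x ≈ f []
  multilinearExt-zero f x = trans (+-identityʳ _) (*-identityʳ _)

  multilinearExt-suc : ∀ n f x → ext (suc n) f x ≈
    interpolate (head x) (ext n (f ∘ (true ∷_)) (tail x)) (ext n (f ∘ (false ∷_)) (tail x))
  multilinearExt-suc n f x = sumList-allSubsets-suc n (head x) (1# - head x)
    (λ S → x∙yz≈y∙xz (f (true ∷ S)) _ _) (λ S → x∙yz≈y∙xz (f (false ∷ S)) _ _)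

  multilinearExt-const : ∀ n a x → ext n (λ _ → a) x ≈ a
  multilinearExt-const zero    a x = multilinearExt-zero (λ _ → a) x
  multilinearExt-const (suc n) a x = begin-equality
    ext (suc n) (λ _ → a) x    ≈⟨ multilinearExt-suc n (λ _ → a) x ⟩
    interpolate (head x) E E   ≈⟨ interpolate-cong (head x) IH IH ⟩
    interpolate (head x) a a   ≈⟨ interpolate-const (head x) a ⟩
    a                          ∎
    where
    E = ext n (λ _ → a) (tail x)
    IH = multilinearExt-const n a (tail x)

  multilinearExt-homo₂ : ∀ (_∙_ : Op₂ Carrier) → Congruent₂ _∙_ →
    (∀ t a b a′ b′ → interpolate t (a ∙ a′) (b ∙ b′) ≈
                      interpolate t a b ∙ interpolate t a′ b′) →
    ∀ n f g x → ext n (λ S → f S ∙ g S) x ≈ ext n f x ∙ ext n g x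
  multilinearExt-homo₂ _∙_ ∙-cong interpolate-∙ zero f g x =
    trans (multilinearExt-zero (λ S → f S ∙ g S) x)
          (∙-cong (sym (multilinearExt-zero f x)) (sym (multilinearExt-zero g x)))
  multilinearExt-homo₂ _∙_ ∙-cong interpolate-∙ (suc n) f g x = begin-equality
    ext (suc n) (λ S → f S ∙ g S) x
      ≈⟨ multilinearExt-suc n _ x ⟩
    interpolate t (E true (λ S → f S ∙ g S)) (E false (λ S → f S ∙ g S))
      ≈⟨ interpolate-cong t (IH true) (IH false) ⟩
    interpolate t (E true f ∙ E true g) (E false f ∙ E false g)
      ≈⟨ interpolate-∙ t _ _ _ _ ⟩
    interpolate t (E true f) (E false f) ∙ interpolate t (E true g) (E false g)
      ≈⟨ ∙-cong (multilinearExt-suc n f x) (multilinearExt-suc n g x) ⟨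
    ext (suc n) f x ∙ ext (suc n) g x ∎
    where
    t = head x
    E : Bool → (Subset (suc n) → Carrier) → Carrier
    E b h = ext n (h ∘ (b ∷_)) (tail x)
    IH = λ b → multilinearExt-homo₂ _∙_ ∙-cong interpolate-∙ n (f ∘ (b ∷_)) (g ∘ (b ∷_)) (tail x)

  multilinearExt-linear : ∀ n k f g x → ext n (λ S → k * f S + g S) x ≈ k * ext n f x + ext n g x
  multilinearExt-linear n k = multilinearExt-homo₂ (λ a b → k * a + b)
    (λ a≈a′ b≈b′ → +-cong (*-congˡ a≈a′) b≈b′)
    (λ t a b a′ b′ → trans (interpolate-+ t _ _ _ _) (+-congʳ (interpolate-*ˡ t k a b))) n

  multilinearExt-difference : ∀ n f g x → ext n (λ S → f S - g S) x ≈ ext n f x - ext n g x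
  multilinearExt-difference =
    multilinearExt-homo₂ _-_ (λ a≈a′ b≈b′ → +-cong a≈a′ (-‿cong b≈b′)) interpolate-difference

  multilinearExt-mixture : ∀ n N p (f : Fin N → Subset n → Carrier) x →
    ext n (mixture K N p f) x ≈ sumFin K N (λ i → p i * ext n (f i) x)
  multilinearExt-mixture n zero    p f x = multilinearExt-const n 0# x
  multilinearExt-mixture n (suc N) p f x =
    trans (multilinearExt-linear n (p zero) (f zero) (mixture K N (p ∘ suc) (f ∘ suc)) x)
          (+-congˡ (multilinearExt-mixture n N (p ∘ suc) (f ∘ suc) x))

  multilinearExt-monoˡ : ∀ n {f g} x → (∀ S → f S ≤ g S) → InUnitCube K n x → ext n f x ≤ ext n g x
  multilinearExt-monoˡ zero    {f} {g} x f≤g x∈cube = begin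
    ext 0 f x ≈⟨ multilinearExt-zero f x ⟩
    f []      ≤⟨ f≤g [] ⟩
    g []      ≈⟨ multilinearExt-zero g x ⟨
    ext 0 g x ∎
  multilinearExt-monoˡ (suc n) {f} {g} x f≤g x∈cube = begin
    ext (suc n) f x
      ≈⟨ multilinearExt-suc n f x ⟩
    interpolate (head x) (ext n (f ∘ (true ∷_)) (tail x)) (ext n (f ∘ (false ∷_)) (tail x))
      ≤⟨ interpolate-mono-endpoints (x∈cube zero) (IH true) (IH false) ⟩
    interpolate (head x) (ext n (g ∘ (true ∷_)) (tail x)) (ext n (g ∘ (false ∷_)) (tail x))
      ≈⟨ multilinearExt-suc n g x ⟨
    ext (suc n) g x ∎
    where IH = λ b → multilinearExt-monoˡ n (tail x) (f≤g ∘ (b ∷_)) (x∈cube ∘ suc)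

  multilinearExt-nonneg : ∀ n {f} x → (∀ S → 0# ≤ f S) → InUnitCube K n x → 0# ≤ ext n f x
  multilinearExt-nonneg n x 0≤f x∈cube =
    ≤-respˡ-≈ (multilinearExt-const n 0# x) (multilinearExt-monoˡ n x 0≤f x∈cube)

  private
    sign : ∀ {n} → Subset n → Fin n → Carrier
    sign S e = if lookup S e then 1# else - 1#

  gradMultilinearExt-zero : ∀ n f x →
    ∇ (suc n) f x zero ≈ ext n (f ∘ (true ∷_)) (tail x) - ext n (f ∘ (false ∷_)) (tail x)
  gradMultilinearExt-zero n f x = trans
    (sumList-allSubsets-suc n 1# (- 1#)
      (λ S → solve 2 (λ a q → a :* (1ₚ :* (1ₚ :* q)) := 1ₚ :* (a :* q)) refl (f (true ∷ S)) _)
      (λ S → solve 2 (λ a q → a :* (:- 1ₚ :* (1ₚ :* q)) := :- 1ₚ :* (a :* q)) refl (f (false ∷ S)) _))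
    (solve 2 (λ a b → 1ₚ :* a :+ :- 1ₚ :* b := a :- b) refl _ _)

  factorExcept-∷ : ∀ {n} b (S : Subset n) x e e′ →
    factorExcept K (b ∷ S) x (suc e) (suc e′) ≡ factorExcept K S (tail x) e e′
  factorExcept-∷ b S x e e′ with e′ ≟ e
  ... | yes _ = ≡.refl
  ... | no  _ = ≡.refl

  gradMultilinearExt-suc : ∀ n f x e → ∇ (suc n) f x (suc e) ≈
    interpolate (head x) (∇ n (f ∘ (true ∷_)) (tail x) e) (∇ n (f ∘ (false ∷_)) (tail x) e)
  gradMultilinearExt-suc n f x e =
    sumList-allSubsets-suc n (head x) (1# - head x) (summand true) (summand false)
    where
    summand : ∀ b S →
      f (b ∷ S) * (sign (b ∷ S) (suc e) * prodFin K (suc n) (factorExcept K (b ∷ S) x (suc e))) ≈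
      factor K (b ∷ S) x zero * (f (b ∷ S) * (sign S e * prodFin K n (factorExcept K S (tail x) e)))
    summand b S = trans
      (*-congˡ (*-congˡ (*-congˡ (reflexive (prodFin-cong n (factorExcept-∷ b S x e))))))
      (solve 4 (λ a s w q → a :* (s :* (w :* q)) := w :* (a :* (s :* q))) refl _ _ _ _)

  marginalGain : ∀ {n} → Fin n → (Subset n → Carrier) → Subset n → Carrier
  marginalGain e f T = f (T [ e ]≔ true) - f (T [ e ]≔ false)

  gradMultilinearExt-marginalGain : ∀ n f x e → ∇ n f x e ≈ ext n (marginalGain e f) x
  gradMultilinearExt-marginalGain (suc n) f x zero = begin-equality
    ∇ (suc n) f x zero
      ≈⟨ gradMultilinearExt-zero n f x ⟩
    ext n (f ∘ (true ∷_)) (tail x) - ext n (f ∘ (false ∷_)) (tail x)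
      ≈⟨ multilinearExt-difference n _ _ (tail x) ⟨
    E
      ≈⟨ interpolate-const (head x) E ⟨
    interpolate (head x) E E
      ≈⟨ multilinearExt-suc n (marginalGain zero f) x ⟨
    ext (suc n) (marginalGain zero f) x ∎
    where E = ext n (λ S → f (true ∷ S) - f (false ∷ S)) (tail x)
  gradMultilinearExt-marginalGain (suc n) f x (suc e) = begin-equality
    ∇ (suc n) f x (suc e)
      ≈⟨ gradMultilinearExt-suc n f x e ⟩
    interpolate (head x) (∇ n (f ∘ (true ∷_)) (tail x) e) (∇ n (f ∘ (false ∷_)) (tail x) e)
      ≈⟨ interpolate-cong (head x) (IH (f ∘ (true ∷_))) (IH (f ∘ (false ∷_))) ⟩
    interpolate (head x) (ext n (marginalGain e (f ∘ (true ∷_))) (tail x))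
                         (ext n (marginalGain e (f ∘ (false ∷_))) (tail x))
      ≈⟨ multilinearExt-suc n (marginalGain (suc e) f) x ⟨
    ext (suc n) (marginalGain (suc e) f) x ∎
    where IH = λ f′ → gradMultilinearExt-marginalGain n f′ (tail x) e

  monotone-∷ : ∀ {n} {f : Subset (suc n) → Carrier} b → Monotone K f → Monotone K (f ∘ (b ∷_))
  monotone-∷ b mono S T S⊆T = mono (b ∷ S) (b ∷ T) (s⊆s S⊆T)

  submodular-∷ : ∀ {n} {f : Subset (suc n) → Carrier} b → Submodular K f → Submodular K (f ∘ (b ∷_))
  submodular-∷ true  sub S T = sub (true ∷ S) (true ∷ T)
  submodular-∷ false sub S T = sub (false ∷ S) (false ∷ T)

  marginalGain-nonneg : ∀ {n} {f : Subset n → Carrier} → Monotone K f →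
                        ∀ e T → 0# ≤ marginalGain e f T
  marginalGain-nonneg mono e T = x≤y⇒0≤y-x (mono _ _ (p[e]≔false⊆p[e]≔true T e))

  marginalGain-antitone-∷ : ∀ {n} {f : Subset (suc n) → Carrier} → Submodular K f → ∀ e T →
    marginalGain e (f ∘ (true ∷_)) T ≤ marginalGain e (f ∘ (false ∷_)) T
  marginalGain-antitone-∷ {f = f} sub e T = x+y≤z+w⇒x-z≤w-y (begin
    f (true ∷ T⁺) + f (false ∷ T⁻)
      ≡⟨ ≡.cong₂ (λ U V → f (true ∷ U) + f (false ∷ V))
                 (p[e]≔false∪p[e]≔true T e) (p[e]≔false∩p[e]≔true T e) ⟨
    f (true ∷ (T⁻ ∪ T⁺)) + f (false ∷ (T⁻ ∩ T⁺))
      ≤⟨ sub (true ∷ T⁻) (false ∷ T⁺) ⟩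
    f (true ∷ T⁻) + f (false ∷ T⁺) ∎)
    where
    T⁺ = T [ e ]≔ true
    T⁻ = T [ e ]≔ false

  gradMultilinearExt-nonneg : ∀ n {f} x → Monotone K f → InUnitCube K n x → ∀ e → 0# ≤ ∇ n f x e
  gradMultilinearExt-nonneg n {f} x mono x∈cube e =
    ≤-respʳ-≈ (sym (gradMultilinearExt-marginalGain n f x e))
      (multilinearExt-nonneg n x (marginalGain-nonneg mono e) x∈cube)

  gradMultilinearExt-antitone-∷ : ∀ n {f : Subset (suc n) → Carrier} x → Submodular K f →
    InUnitCube K n x → ∀ e → ∇ n (f ∘ (true ∷_)) x e ≤ ∇ n (f ∘ (false ∷_)) x e
  gradMultilinearExt-antitone-∷ n {f} x sub x∈cube e = begin
    ∇ n (f ∘ (true ∷_)) x e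
      ≈⟨ gradMultilinearExt-marginalGain n _ x e ⟩
    ext n (marginalGain e (f ∘ (true ∷_))) x
      ≤⟨ multilinearExt-monoˡ n x (marginalGain-antitone-∷ sub e) x∈cube ⟩
    ext n (marginalGain e (f ∘ (false ∷_))) x
      ≈⟨ gradMultilinearExt-marginalGain n _ x e ⟨
    ∇ n (f ∘ (false ∷_)) x e ∎

  multilinearExt-monoʳ : ∀ n {f} → Monotone K f → ∀ {y z} → InUnitCube K n y → InUnitCube K n z →
    (∀ e → y e ≤ z e) → ext n f y ≤ ext n f z
  multilinearExt-monoʳ zero    mono y∈cube z∈cube y≤z = ≤-refl
  multilinearExt-monoʳ (suc n) {f} mono {y} {z} y∈cube z∈cube y≤z = begin
    ext (suc n) f y
      ≈⟨ multilinearExt-suc n f y ⟩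
    interpolate (head y) (ext n (f ∘ (true ∷_)) (tail y)) (ext n (f ∘ (false ∷_)) (tail y))
      ≤⟨ interpolate-mono-weight (y≤z zero)
           (multilinearExt-monoˡ n (tail y) (λ S → mono _ _ (out⊆ ⊆-refl)) (y∈cube ∘ suc)) ⟩
    interpolate (head z) (ext n (f ∘ (true ∷_)) (tail y)) (ext n (f ∘ (false ∷_)) (tail y))
      ≤⟨ interpolate-mono-endpoints (z∈cube zero) (IH true) (IH false) ⟩
    interpolate (head z) (ext n (f ∘ (true ∷_)) (tail z)) (ext n (f ∘ (false ∷_)) (tail z))
      ≈⟨ multilinearExt-suc n f z ⟨
    ext (suc n) f z ∎
    where
    IH = λ b → multilinearExt-monoʳ n (monotone-∷ b mono) (y∈cube ∘ suc) (z∈cube ∘ suc) (y≤z ∘ suc)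

  inner-gradMultilinearExt-suc : ∀ n f x d → inner K (suc n) d (∇ (suc n) f x) ≈
    head d * (ext n (f ∘ (true ∷_)) (tail x) - ext n (f ∘ (false ∷_)) (tail x)) +
    interpolate (head x) (inner K n (tail d) (∇ n (f ∘ (true ∷_)) (tail x)))
                         (inner K n (tail d) (∇ n (f ∘ (false ∷_)) (tail x)))
  inner-gradMultilinearExt-suc n f x d = +-cong (*-congˡ (gradMultilinearExt-zero n f x)) (begin-equality
    sumFin K n (λ e → d (suc e) * ∇ (suc n) f x (suc e))
      ≈⟨ sumFin-cong n (λ e → *-congˡ (gradMultilinearExt-suc n f x e)) ⟩
    sumFin K n (λ e → d (suc e) * interpolate (head x) (∇₁ e) (∇₀ e))
      ≈⟨ sumFin-cong n (λ e → interpolate-*ˡ (head x) (d (suc e)) (∇₁ e) (∇₀ e)) ⟨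
    sumFin K n (λ e → interpolate (head x) (d (suc e) * ∇₁ e) (d (suc e) * ∇₀ e))
      ≈⟨ sumFin-interpolate n (head x) _ _ ⟩
    interpolate (head x) (inner K n (tail d) ∇₁) (inner K n (tail d) ∇₀) ∎)
    where
    ∇₁ = ∇ n (f ∘ (true ∷_)) (tail x)
    ∇₀ = ∇ n (f ∘ (false ∷_)) (tail x)

  multilinearExt-concave-nonneg-direction : ∀ n {f} → Submodular K f →
    ∀ {x d} → InUnitCube K n x → (∀ e → 0# ≤ d e) →
    InUnitCube K n (λ e → x e + d e) →
    ext n f (λ e → x e + d e) ≤ ext n f x + inner K n d (∇ n f x)
  multilinearExt-concave-nonneg-direction zero sub x∈cube 0≤d z∈cube =
    ≤-reflexive (sym (+-identityʳ _))
  multilinearExt-concave-nonneg-direction (suc n) {f} sub {x} {d} x∈cube 0≤d z∈cube = begin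
    ext (suc n) f z
      ≈⟨ multilinearExt-suc n f z ⟩
    interpolate s (C true) (C false)
      ≤⟨ interpolate-mono-endpoints (z∈cube zero) (IH true) (IH false) ⟩
    interpolate s (A true + D true) (A false + D false)
      ≈⟨ interpolate-+ s _ _ _ _ ⟩
    interpolate s (A true) (A false) + interpolate s (D true) (D false)
      ≤⟨ +-monoʳ-≤ _ (interpolate-anti-weight (x≤x+y (0≤d zero)) D₁≤D₀) ⟩
    interpolate s (A true) (A false) + interpolate t (D true) (D false)
      ≈⟨ +-congʳ (interpolate-+-weight t (head d) _ _) ⟩
    interpolate t (A true) (A false) + head d * (A true - A false) + interpolate t (D true) (D false)
      ≈⟨ +-assoc _ _ _ ⟩
    interpolate t (A true) (A false) + (head d * (A true - A false) + interpolate t (D true) (D false))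
      ≈⟨ +-cong (multilinearExt-suc n f x) (inner-gradMultilinearExt-suc n f x d) ⟨
    ext (suc n) f x + inner K (suc n) d (∇ (suc n) f x) ∎
    where
    z = λ e → x e + d e
    t = head x
    s = head z
    A C D : Bool → Carrier
    A b = ext n (f ∘ (b ∷_)) (tail x)
    C b = ext n (f ∘ (b ∷_)) (tail z)
    D b = inner K n (tail d) (∇ n (f ∘ (b ∷_)) (tail x))
    IH : ∀ b → C b ≤ A b + D b
    IH b = multilinearExt-concave-nonneg-direction n (submodular-∷ b sub)
             (x∈cube ∘ suc) (0≤d ∘ suc) (z∈cube ∘ suc)
    D₁≤D₀ : D true ≤ D false
    D₁≤D₀ = sumFin-mono-≤ n (λ e → *-monoʳ-≤-nonneg (0≤d (suc e))
      (gradMultilinearExt-antitone-∷ n (tail x) sub (x∈cube ∘ suc) e))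

  multilinearExt-first-order-bound : ∀ n {f} → Monotone K f → Submodular K f → ∀ {x y} →
    InUnitCube K n x → InUnitCube K n y → ext n f y ≤ ext n f x + inner K n y (∇ n f x)
  multilinearExt-first-order-bound n {f} mono sub {x} {y} x∈cube y∈cube = begin
    ext n f y
      ≤⟨ multilinearExt-monoʳ n mono y∈cube z∈cube y≤z ⟩
    ext n f z
      ≤⟨ multilinearExt-concave-nonneg-direction n sub x∈cube 0≤d z∈cube ⟩
    ext n f x + inner K n d (∇ n f x)
      ≤⟨ +-monoʳ-≤ _ (sumFin-mono-≤ n (λ e → *-monoˡ-≤-nonneg (0≤∇ e) (d≤y e))) ⟩
    ext n f x + inner K n y (∇ n f x) ∎
    where
    -- z e = 1 - (1 - x e)(1 - y e), the probability that e lies in the union of independent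
    -- samples of x and y.
    d z : Fin n → Carrier
    d e = (1# - x e) * y e
    z e = x e + d e
    0≤d : ∀ e → 0# ≤ d e
    0≤d e = *-nonneg (x≤y⇒0≤y-x (proj₂ (x∈cube e))) (proj₁ (y∈cube e))
    y≤z : ∀ e → y e ≤ z e
    y≤z e = ≤-by-difference (x e * (1# - y e))
      (solve 2 (λ x y → (x :+ (1ₚ :- x) :* y) :- y := x :* (1ₚ :- y)) refl (x e) (y e))
      (*-nonneg (proj₁ (x∈cube e)) (x≤y⇒0≤y-x (proj₂ (y∈cube e))))
    z∈cube : InUnitCube K n z
    z∈cube e = +-nonneg (proj₁ (x∈cube e)) (0≤d e) , ≤-by-difference ((1# - x e) * (1# - y e))
      (solve 2 (λ x y → 1ₚ :- (x :+ (1ₚ :- x) :* y) := (1ₚ :- x) :* (1ₚ :- y)) refl (x e) (y e))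
      (*-nonneg (x≤y⇒0≤y-x (proj₂ (x∈cube e))) (x≤y⇒0≤y-x (proj₂ (y∈cube e))))
    d≤y : ∀ e → d e ≤ y e
    d≤y e = ≤-by-difference (x e * y e)
      (solve 2 (λ x y → y :- (1ₚ :- x) :* y := x :* y) refl (x e) (y e))
      (*-nonneg (proj₁ (x∈cube e)) (proj₁ (y∈cube e)))
    0≤∇ : ∀ e → 0# ≤ ∇ n f x e
    0≤∇ = gradMultilinearExt-nonneg n x mono x∈cube

corollaryA2 : ∀ {c ℓ₁ ℓ₂} (K : OrderedField c ℓ₁ ℓ₂) →
    let open OrderedField K in
    (n N m : ℕ) →
    (f : Fin N → Subset n → Carrier) →
    (∀ i → NonNegative K (f i)) →
    (∀ i → Monotone K (f i)) →
    (∀ i → Submodular K (f i)) →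
    (∀ i → Normalized K (f i)) →
    (p : Fin N → Carrier) →
    (∀ i → 0# ≤ p i) →
    sumFin K N p ≈ 1# →
    (A : Fin m → Fin n → Carrier) → (b : Fin m → Carrier) →
    (∀ y → InPolytope K n A b y → InUnitCube K n y) →
    (OPT : Carrier) →
    Σ (Fin n → Carrier) (λ xs → InPolytope K n A b xs × multilinearExt K n (mixture K N p f) xs ≈ OPT) →
    (∀ y → InPolytope K n A b y → multilinearExt K n (mixture K N p f) y ≤ OPT) →
    (x : Fin n → Carrier) → InUnitCube K n x →
    (v : Fin N → Fin n → Carrier) →
    (∀ i → InPolytope K n A b (v i)) →
    (∀ i y → InPolytope K n A b y →
       inner K n y (gradMultilinearExt K n (f i) x)
         ≤ inner K n (v i) (gradMultilinearExt K n (f i) x)) →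
    OPT - multilinearExt K n (mixture K N p f) x
      ≤ sumFin K N (λ i → p i * inner K n (v i) (gradMultilinearExt K n (f i) x))
corollaryA2 K n N m f _ mono sub _ p 0≤p _ A b P⊆cube OPT (x⋆ , x⋆∈P , F̂x⋆≈OPT) _ x x∈cube v _ v-maximal =
  x≤y+z⇒x-y≤z (begin
    OPT
      ≈⟨ F̂x⋆≈OPT ⟨
    multilinearExt K n (mixture K N p f) x⋆
      ≈⟨ multilinearExt-mixture n N p f x⋆ ⟩
    sumFin K N (λ i → p i * f̂ i x⋆)
      ≤⟨ sumFin-mono-≤ N (λ i → *-monoʳ-≤-nonneg (0≤p i) (bound i)) ⟩
    sumFin K N (λ i → p i * (f̂ i x + ⟨v,∇f̂⟩ i))
      ≈⟨ sumFin-cong N (λ i → distribˡ (p i) _ _) ⟩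
    sumFin K N (λ i → p i * f̂ i x + p i * ⟨v,∇f̂⟩ i)
      ≈⟨ sumFin-+ N _ _ ⟩
    sumFin K N (λ i → p i * f̂ i x) + sumFin K N (λ i → p i * ⟨v,∇f̂⟩ i)
      ≈⟨ +-congʳ (multilinearExt-mixture n N p f x) ⟨
    multilinearExt K n (mixture K N p f) x + sumFin K N (λ i → p i * ⟨v,∇f̂⟩ i) ∎)
  where
  open OrderedField K hiding (zero)
  open OrderedFieldProperties K
  open FiniteSums K
  open MultilinearExtensionProperties K
  open import Relation.Binary.Reasoning.PartialOrder poset

  f̂ : Fin N → (Fin n → Carrier) → Carrier
  f̂ i = multilinearExt K n (f i)

  ⟨v,∇f̂⟩ : Fin N → Carrier
  ⟨v,∇f̂⟩ i = inner K n (v i) (gradMultilinearExt K n (f i) x)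

  bound : ∀ i → f̂ i x⋆ ≤ f̂ i x + ⟨v,∇f̂⟩ i
  bound i = ≤-trans (multilinearExt-first-order-bound n (mono i) (sub i) x∈cube (P⊆cube x⋆ x⋆∈P))
                    (+-monoʳ-≤ _ (v-maximal i x⋆ x⋆∈P))
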